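{- Let $M=(\Sigma,A_{S_0},T_R)$ be a regular system, $LEP=\{\ell ep_1,\dots,\ell ep_k\}$ a set of local execution properties, $\ell osp$ a local-oriented system property over $LEP$, and $M^a_{\neg\ell osp}=(\Sigma^a,A^a_{S_0},T^a_R,F^a)$ the Büchi regular system constructed from them as described in the context. Then: (a) for every accepting execution $\pi^a=\pi^a(0)\pi^a(1)\cdots$ of $M^a_{\neg\ell osp}$, the sequence $\pi=w_0w_1\cdots$ with $w_i=\Pi_\Sigma(\pi^a(i))$ is an execution of $M$ that does not satisfy $\ell osp$; and (b) for every execution $\pi=w_0w_1\cdots$ of $M$ that does not satisfy $\ell osp$, there is an accepting execution $\pi^a$ of $M^a_{\neg\ell osp}$ with $\Pi_\Sigma(\pi^a(i))=w_i$ for all $i$.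
   Context: A regular system $M=(\Sigma,A_{S_0},T_R)$ consists of a finite alphabet $\Sigma$, a deterministic finite-word automaton $A_{S_0}$ over $\Sigma$ (initial states $L(A_{S_0})$) and a deterministic finite-word transducer $T_R=(Q_R,\Sigma\times\Sigma,q_{0R},\delta_R,F_R)$ representing the relation $R$ of equal-length pairs $(u,v)$ with $(u(0),v(0))\cdots(u(n-1),v(n-1))$ accepted. An execution of $M$ is an infinite sequence $\pi=w_0w_1\cdots$ with $w_0\in L(A_{S_0})$ and $(w_i,w_{i+1})\in R$ (all executions assumed infinite); all $w_i$ then have a common length $n$. For $0\le j<n$ the $j$-th local projection is the infinite word $\Pi_j(\pi)=w_0(j)w_1(j)w_2(j)\cdots$. A local execution property is a set $\ell ep\subseteq\Sigma^\omega$; each $\ell ep_i$ is recognized by a complete Büchi automaton $A_{\ell ep_i}=(Q_{\ell ep_i},\Sigma,q_{0,\ell ep_i},\Delta_{\ell ep_i},F_{\ell ep_i})$, and $A_{\neg\ell ep_i}=(Q_{\neg\ell ep_i},\Sigma,q_{0,\neg\ell ep_i},\Delta_{\neg\ell ep_i},F_{\neg\ell ep_i})$ is a complete Büchi automaton recognizing $\Sigma^\omega\setminus\ell ep_i$. For $x\in\Sigma^\omega$, $\mathbf{lep}(x)=\{\ell ep_i\mid x\in\ell ep_i\}$. A local-oriented system property is a set $\ell osp\subseteq(2^{LEP})^*$ recognized by a finite-word automaton; an execution $\pi$ satisfies $\ell osp$ iff $\mathbf{lep}(\Pi_0(\pi))\cdots\mathbf{lep}(\Pi_{n-1}(\pi))\in\ell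 osp$. Construction: $\Sigma^a=\Sigma\times\prod_{i=1}^kQ_{\ell ep_i}\times\prod_{i=1}^kQ_{\neg\ell ep_i}\times2^{LEP}\times2^{LEP}\times\{reset,noreset\}$, with $\Pi_\Sigma$ the letterwise projection onto $\Sigma$. The transducer $T^a_R$ has state set $Q_R$, initial state $q_{0R}$, accepting states $F_R$, and a transition from $q$ to $q'$ on the letter pair $((a_1,p_1,\dots,p_k,\bar p_1,\dots,\bar p_k,L_1,G_1,\rho_1),(a_2,p_1',\dots,p_k',\bar p_1',\dots,\bar p_k',L_2,G_2,\rho_2))$ iff: $q'\in\delta_R(q,(a_1,a_2))$; $p_i'\in\Delta_{\ell ep_i}(p_i,a_1)$ and $\bar p_i'\in\Delta_{\neg\ell ep_i}(\bar p_i,a_1)$ for $1\le i\le k$; $L_1=L_2$; and if $G_1=LEP$ then either ($G_2=\emptyset$ and $\rho_2=reset$) or ($G_2=G_1$ and $\rho_2=noreset$), while otherwise $G_2=G_1\cup\{\ell ep_i\in L_1\mid p_i\in F_{\ell ep_i}\}\cup\{\ell ep_i\notin L_1\mid\bar p_i\in F_{\neg\ell ep_i}\}$ and $\rho_2=noreset$. $R^a$ is the set of equal-length word pairs over $\Sigma^a$ accepted by $T^a_R$. The initial states $L(A^a_{S_0})$ are the words whose $j$-th letter ($0\le j<n$) is $(w(j),q_{0,\ell ep_1},\dots,q_{0,\ell ep_k},q_{0,\neg\ell ep_1},\dots,q_{0,\neg\ell ep_k},L^{(j)},\emptyset,noreset)$, where $w(0)\cdots w(n-1)\in L(A_{S_0})$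 and $L^{(0)}\cdots L^{(n-1)}\in(2^{LEP})^*\setminus\ell osp$. $L(F^a)$ is the set of words over $\Sigma^a$ all of whose letters have last component $reset$. An execution of $M^a_{\neg\ell osp}$ is an infinite sequence $w^a_0w^a_1\cdots$ with $w^a_0\in L(A^a_{S_0})$ and $(w^a_i,w^a_{i+1})\in R^a$; it is accepting if $w^a_i\in L(F^a)$ for infinitely many $i$. -}

module Defs where

open import Level using (0ℓ)
open import Data.Nat using (ℕ; zero; suc; _≤_)
open import Data.Fin using (Fin)
open import Data.Bool using (Bool; true; false; _∨_; if_then_else_)
open import Data.Maybe using (Maybe; just)
open import Data.Product using (Σ; ∃; ∃-syntax; _×_; _,_)
open import Data.Sum using (_⊎_)
open import Data.List using (List; []; _∷_)
open import Data.Vec using (Vec; lookup; toList; map; zip; tabulate)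
open import Data.Fin.Subset using (Subset; ⊤; ⊥)
open import Relation.Nullary using (¬_)
open import Relation.Binary.PropositionalEquality using (_≡_; _≢_)
open import Function.Bundles using (_⇔_)

data Run {Q A : Set} (Step : Q → A → Q → Set) (Fin' : Q → Set) : Q → List A → Set where
  done : ∀ {q} → Fin' q → Run Step Fin' q []
  step : ∀ {q a q' w} → Step q a q' → Run Step Fin' q' w → Run Step Fin' q (a ∷ w)

record DFA (A : Set) : Set where
  field
    nQ  : ℕ
    q₀  : Fin nQ
    δ   : Fin nQ → A → Maybe (Fin nQ)
    acc : Fin nQ → Bool

DFAAccepts : ∀ {A} → DFA A → List A → Set
DFAAccepts D w = Run (λ q a q' → δ q a ≡ just q') (λ q → acc q ≡ true) q₀ w
  where open DFA D

record NFA (A : Set) : Set where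
  field
    nQ  : ℕ
    q₀  : Fin nQ
    Δ   : Fin nQ → A → Fin nQ → Bool
    acc : Fin nQ → Bool

NFAAccepts : ∀ {A} → NFA A → List A → Set
NFAAccepts N w = Run (λ q a q' → Δ q a q' ≡ true) (λ q → acc q ≡ true) q₀ w
  where open NFA N

record NBA (A : Set) : Set where
  field
    nQ  : ℕ
    q₀  : Fin nQ
    Δ   : Fin nQ → A → Fin nQ → Bool
    acc : Fin nQ → Bool

NBA-Q : ∀ {A} → NBA A → Set
NBA-Q B = Fin (NBA.nQ B)

Complete : ∀ {A} → NBA A → Set
Complete B = ∀ q a → ∃[ q' ] Δ q a q' ≡ true
  where open NBA B

InfOften : (ℕ → Set) → Set
InfOften P = ∀ m → ∃[ t ] (m ≤ t × P t)

BAccepts : ∀ {A} → NBA A → (ℕ → A) → Set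
BAccepts B x = Σ (ℕ → Fin nQ) λ r → (r 0 ≡ q₀ × (∀ t → Δ (r t) (x t) (r (suc t)) ≡ true)
                      × InfOften (λ t → acc (r t) ≡ true))
  where open NBA B

record RegSys (s : ℕ) : Set where
  field
    A-S₀ : DFA (Fin s)
    T-R  : DFA (Fin s × Fin s)

module _ {s : ℕ} (M : RegSys s) where
  open RegSys M

  InR : ∀ {n} → Vec (Fin s) n → Vec (Fin s) n → Set
  InR u v = DFAAccepts T-R (toList (zip u v))

  IsExec : ∀ {n} → (ℕ → Vec (Fin s) n) → Set
  IsExec π = DFAAccepts A-S₀ (toList (π 0)) × (∀ t → InR (π t) (π (suc t)))

Proj : ∀ {s n} → (ℕ → Vec (Fin s) n) → Fin n → ℕ → Fin s
Proj π j t = lookup (π t) j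

module _ {s k : ℕ} (A : Fin k → NBA (Fin s)) where

  -- Ls is the word lep(Π₀ π) ⋯ lep(Π_{n-1} π) (sets over LEP as Subset k,
  -- ℓep_i ∈ Ls_j  iff  Π_j π ∈ L(A_i))
  IsLepWord : ∀ {n} → (ℕ → Vec (Fin s) n) → Vec (Subset k) n → Set
  IsLepWord π Ls = ∀ j i → (lookup (lookup Ls j) i ≡ true ⇔ BAccepts (A i) (Proj π j))

  Satisfies : NFA (Subset k) → ∀ {n} → (ℕ → Vec (Fin s) n) → Set
  Satisfies losp π = ∃[ Ls ] (IsLepWord π Ls × NFAAccepts losp (toList Ls))

data Rst : Set where
  reset noreset : Rst

module Construction {s k : ℕ} (M : RegSys s) (A A¬ : Fin k → NBA (Fin s))
                    (losp : NFA (Subset k)) where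

  open RegSys M

  record Letter : Set where
    constructor mkLetter
    field
      sym : Fin s
      ps  : (i : Fin k) → NBA-Q (A i)
      nps : (i : Fin k) → NBA-Q (A¬ i)
      L   : Subset k
      G   : Subset k
      ρ   : Rst
  open Letter public

  update : Letter → Subset k
  update l = tabulate (λ i → lookup (G l) i ∨
                 (if lookup (L l) i then NBA.acc (A i) (ps l i)
                                    else NBA.acc (A¬ i) (nps l i)))

  StepA : Fin (DFA.nQ T-R) → Letter × Letter → Fin (DFA.nQ T-R) → Set
  StepA q (l₁ , l₂) q' =
      DFA.δ T-R q (sym l₁ , sym l₂) ≡ just q'
    × (∀ i → NBA.Δ (A i) (ps l₁ i) (sym l₁) (ps l₂ i) ≡ true)
    × (∀ i → NBA.Δ (A¬ i) (nps l₁ i) (sym l₁) (nps l₂ i) ≡ true)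
    × L l₁ ≡ L l₂
    × ( (G l₁ ≡ ⊤ × ((G l₂ ≡ ⊥ × ρ l₂ ≡ reset) ⊎ (G l₂ ≡ G l₁ × ρ l₂ ≡ noreset)))
      ⊎ (G l₁ ≢ ⊤ × G l₂ ≡ update l₁ × ρ l₂ ≡ noreset))

  InRa : ∀ {n} → Vec Letter n → Vec Letter n → Set
  InRa u v = Run StepA (λ q → DFA.acc T-R q ≡ true) (DFA.q₀ T-R) (toList (zip u v))

  InitA : ∀ {n} → Vec Letter n → Set
  InitA w = DFAAccepts A-S₀ (toList (map sym w))
          × (∀ j → let l = lookup w j in
               (∀ i → ps l i ≡ NBA.q₀ (A i))
             × (∀ i → nps l i ≡ NBA.q₀ (A¬ i))
             × G l ≡ ⊥
             × ρ l ≡ noreset)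
          × ¬ NFAAccepts losp (toList (map L w))

  InFA : ∀ {n} → Vec Letter n → Set
  InFA w = ∀ j → ρ (lookup w j) ≡ reset

  IsAccExecA : ∀ {n} → (ℕ → Vec Letter n) → Set
  IsAccExecA πa = InitA (πa 0) × (∀ t → InRa (πa t) (πa (suc t))) × InfOften (λ t → InFA (πa t))

-- Each position j of an augmented word runs, next to the symbol of M, one run
-- of every A_{ℓep_i} and of every A_{¬ℓep_i}, a guessed set L_j ⊆ LEP and an
-- accumulator G_j.  For each i exactly one of the two runs is "monitored": the
-- run of A_{ℓep_i} if ℓep_i ∈ L_j, else the run of A_{¬ℓep_i}; a step adds i to
-- G_j when the monitored run visits an accepting state.  A global reset (all
-- G_j = LEP, then all G_j := ∅) therefore happens infinitely often iff every
-- monitored run is Büchi accepting.  This is captured by the record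
-- MonitoredRuns, and since A_{¬ℓep_i} accepts exactly the complement, the
-- guess b is then forced to be the truth value of "Π_j(π) ∈ ℓep_i".
module Submission where

open import Defs
open import Level using (0ℓ)
open import Data.Nat using (ℕ; zero; suc; _≤_; _≤′_; ≤′-reflexive; ≤′-step; s≤s; _⊔_)
open import Data.Nat.Properties using (≤-trans; ≤⇒≤′; ≤′⇒≤; m≤n⇒m≤1+n; n≤1+n; m≤m⊔n; m≤n⊔m)
open import Data.Fin using (Fin; zero; suc)
open import Data.Fin.Properties using (all?)
open import Data.Fin.Subset using (Subset; ⊤; ⊥)
open import Data.Vec using (Vec; map; lookup; tabulate; zip; toList; []; _∷_)
open import Data.Vec.Properties using (lookup-map; lookup∘tabulate; lookup-replicate; ≡-dec)
open import Data.Vec.Relation.Binary.Pointwise.Extensional using (ext; Pointwise-≡⇒≡)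
open import Data.Bool using (Bool; true; false; _∨_; if_then_else_)
open import Data.Bool.Properties using (∨-zeroʳ) renaming (_≟_ to _≟ᵇ_)
open import Data.Product using (∃-syntax; _×_; _,_; proj₁; proj₂)
open import Data.Sum using (_⊎_; inj₁; inj₂)
open import Data.Maybe using (just)
open import Data.Empty using (⊥-elim)
open import Relation.Nullary using (¬_; Dec; yes; no)
open import Relation.Binary.PropositionalEquality
  using (_≡_; _≢_; refl; trans; cong; subst; subst₂) renaming (sym to sym≡)
open import Function.Bundles using (_⇔_; mk⇔; Equivalence)
open import Axiom.ExcludedMiddle using (ExcludedMiddle)

vec-ext : ∀ {X : Set} {n} {u v : Vec X n} → (∀ j → lookup u j ≡ lookup v j) → u ≡ v
vec-ext h = Pointwise-≡⇒≡ (ext h)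

bit-⊤ : ∀ {k} {g : Subset k} (i : Fin k) → g ≡ ⊤ → lookup g i ≡ true
bit-⊤ i refl = lookup-replicate i true

bit-⊥ : ∀ {k} {g : Subset k} (i : Fin k) → g ≡ ⊥ → lookup g i ≡ false
bit-⊥ i refl = lookup-replicate i false

bool-unique : ∀ {P : Set} {b c : Bool} → (b ≡ true ⇔ P) → (c ≡ true ⇔ P) → b ≡ c
bool-unique {b = true}  {true}  _ _ = refl
bool-unique {b = false} {false} _ _ = refl
bool-unique {b = true}  {false} b⇔ c⇔ with Equivalence.from c⇔ (Equivalence.to b⇔ refl)
... | ()
bool-unique {b = false} {true}  b⇔ c⇔ with Equivalence.from b⇔ (Equivalence.to c⇔ refl)
... | ()

rise : (b : ℕ → Bool) {a c : ℕ} → a ≤′ c → b a ≡ false → b c ≡ true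
     → ∃[ u ] (a ≤ u × b u ≡ false × b (suc u) ≡ true)
rise b (≤′-reflexive refl) off on with trans (sym≡ on) off
... | ()
rise b {c = suc c} (≤′-step a≤′c) off on with b c in bc
... | true  = rise b a≤′c off bc
... | false = c , ≤′⇒≤ a≤′c , bc , on

persists : (b h : ℕ → Bool) {m u : ℕ} → (∀ t → m ≤ t → b (suc t) ≡ b t ∨ h t)
         → m ≤ u → h u ≡ true → ∀ {t} → suc u ≤′ t → b t ≡ true
persists b h grows m≤u hit (≤′-reflexive refl) =
  trans (grows _ m≤u) (trans (cong (b _ ∨_) hit) (∨-zeroʳ (b _)))
persists b h grows m≤u hit (≤′-step {t} u<t) =
  trans (grows t (≤-trans m≤u (≤-trans (n≤1+n _) (≤′⇒≤ u<t))))
        (cong (_∨ h t) (persists b h grows m≤u hit u<t))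

Eventually : (ℕ → Set) → Set
Eventually P = ∃[ T ] (∀ t → T ≤ t → P t)

eventually-all : ∀ {n} (P : Fin n → ℕ → Set) → (∀ j → Eventually (P j))
               → Eventually (λ t → ∀ j → P j t)
eventually-all {zero}  P ev = 0 , λ _ _ ()
eventually-all {suc n} P ev with ev zero | eventually-all (λ j → P (suc j)) (λ j → ev (suc j))
... | T₀ , p₀ | T₁ , p₁ = T₀ ⊔ T₁ , λ where
  t T≤t zero    → p₀ t (≤-trans (m≤m⊔n T₀ T₁) T≤t)
  t T≤t (suc j) → p₁ t (≤-trans (m≤n⊔m T₀ T₁) T≤t) j

module LiftedRuns {Q X Y : Set} (S : Q → Y × Y → Q → Set) (F : Q → Set)
                  (f : X → Y) (P : X → X → Set) where

  Lifted : Q → X × X → Q → Set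
  Lifted q (x , x') q' = S q (f x , f x') q' × P x x'

  run-forget : ∀ {n q} (u v : Vec X n) → Run Lifted F q (toList (zip u v))
             → Run S F q (toList (zip (map f u) (map f v)))
  run-forget []      []      (done acc)      = done acc
  run-forget (_ ∷ u) (_ ∷ v) (step (s , _) r) = step s (run-forget u v r)

  run-local : ∀ {n q} (u v : Vec X n) → Run Lifted F q (toList (zip u v))
            → ∀ j → P (lookup u j) (lookup v j)
  run-local (_ ∷ u) (_ ∷ v) (step (_ , p) r) zero    = p
  run-local (_ ∷ u) (_ ∷ v) (step _ r)       (suc j) = run-local u v r j

  run-lift : ∀ {n q} (u v : Vec X n) → Run S F q (toList (zip (map f u) (map f v)))
           → (∀ j → P (lookup u j) (lookup v j)) → Run Lifted F q (toList (zip u v))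
  run-lift []      []      (done acc) _ = done acc
  run-lift (_ ∷ u) (_ ∷ v) (step s r) p = step (s , p zero) (run-lift u v r (λ j → p (suc j)))

module _ {X : Set} (B B¬ : NBA X) where

  monitor : Bool → NBA-Q B → NBA-Q B¬ → Bool
  monitor b p p̄ = if b then NBA.acc B p else NBA.acc B¬ p̄

  record MonitoredRuns (x : ℕ → X) (b : Bool) : Set where
    field
      run        : ℕ → NBA-Q B
      run-start  : run 0 ≡ NBA.q₀ B
      run-step   : ∀ t → NBA.Δ B (run t) (x t) (run (suc t)) ≡ true
      run¬       : ℕ → NBA-Q B¬
      run¬-start : run¬ 0 ≡ NBA.q₀ B¬
      run¬-step  : ∀ t → NBA.Δ B¬ (run¬ t) (x t) (run¬ (suc t)) ≡ true
      fires      : InfOften (λ t → monitor b (run t) (run¬ t) ≡ true)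
  open MonitoredRuns public

  monitored-accepts : ∀ {x b} → MonitoredRuns x b → if b then BAccepts B x else BAccepts B¬ x
  monitored-accepts {b = true}  W = run W , run-start W , run-step W , fires W
  monitored-accepts {b = false} W = run¬ W , run¬-start W , run¬-step W , fires W

  membership : ∀ {x b} → (BAccepts B¬ x → ¬ BAccepts B x) → MonitoredRuns x b
             → b ≡ true ⇔ BAccepts B x
  membership {b = true}  _        W = mk⇔ (λ _ → monitored-accepts W) (λ _ → refl)
  membership {b = false} disjoint W = mk⇔ (λ ()) (λ acc → ⊥-elim (disjoint (monitored-accepts W) acc))

  monitoredRuns-cong : ∀ {x y b} → (∀ t → x t ≡ y t) → MonitoredRuns x b → MonitoredRuns y b
  monitoredRuns-cong x≗y W = record
    { run = run W ; run-start = run-start W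
    ; run-step = λ t → subst (λ a → NBA.Δ B (run W t) a (run W (suc t)) ≡ true) (x≗y t) (run-step W t)
    ; run¬ = run¬ W ; run¬-start = run¬-start W
    ; run¬-step = λ t → subst (λ a → NBA.Δ B¬ (run¬ W t) a (run¬ W (suc t)) ≡ true) (x≗y t) (run¬-step W t)
    ; fires = fires W }

anyRun : ∀ {X} (B : NBA X) → Complete B → (ℕ → X) → ℕ → NBA-Q B
anyRun B complete x zero    = NBA.q₀ B
anyRun B complete x (suc t) = proj₁ (complete (anyRun B complete x t) (x t))

anyRun-step : ∀ {X} (B : NBA X) (complete : Complete B) (x : ℕ → X) t
            → NBA.Δ B (anyRun B complete x t) (x t) (anyRun B complete x (suc t)) ≡ true
anyRun-step B complete x t = proj₂ (complete (anyRun B complete x t) (x t))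

monitoredRuns-exist : ∀ {X} {B B¬ : NBA X} → ExcludedMiddle 0ℓ → Complete B → Complete B¬
                    → (x : ℕ → X) → (¬ BAccepts B x → BAccepts B¬ x)
                    → ∃[ b ] MonitoredRuns B B¬ x b
monitoredRuns-exist {B = B} {B¬} em complete complete¬ x covers with em {BAccepts B x}
... | yes (r , r₀ , steps , acc) = true , record
  { run = r ; run-start = r₀ ; run-step = steps
  ; run¬ = anyRun B¬ complete¬ x ; run¬-start = refl ; run¬-step = anyRun-step B¬ complete¬ x
  ; fires = acc }
... | no rejected with covers rejected
...   | r̄ , r̄₀ , steps¬ , acc¬ = false , record
  { run = anyRun B complete x ; run-start = refl ; run-step = anyRun-step B complete x
  ; run¬ = r̄ ; run¬-start = r̄₀ ; run¬-step = steps¬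
  ; fires = acc¬ }

module Accumulator {n k : ℕ} (hit : ℕ → Fin n → Fin k → Bool) where

  Full : (Fin n → Subset k) → Set
  Full g = ∀ j → g j ≡ ⊤

  full? : (g : Fin n → Subset k) → Dec (Full g)
  full? g = all? (λ j → ≡-dec _≟ᵇ_ (g j) ⊤)

  accumulate : ℕ → (g : Fin n → Subset k) → Dec (Full g) → Fin n → Subset k
  accumulate t g (yes _) j = ⊥
  accumulate t g (no _)  j = tabulate (λ i → lookup (g j) i ∨ hit t j i)

  Gs : ℕ → Fin n → Subset k
  Gs zero    j = ⊥
  Gs (suc t) = accumulate t (Gs t) (full? (Gs t))

  accumulate-grows : ∀ t g (d : Dec (Full g)) → ¬ Full g → ∀ j i
                   → lookup (accumulate t g d j) i ≡ lookup (g j) i ∨ hit t j i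
  accumulate-grows t g (yes full) notFull j i = ⊥-elim (notFull full)
  accumulate-grows t g (no _)     notFull j i = lookup∘tabulate _ i

  -- If every hit stream fires infinitely often, the accumulator is full
  -- infinitely often: otherwise it only grows after some m, and then every
  -- bit gets set for good.
  full-infinitely-often : ExcludedMiddle 0ℓ → (∀ j i → InfOften (λ t → hit t j i ≡ true))
                        → InfOften (λ t → Full (Gs t))
  full-infinitely-often em hits m with em {∃[ t ] (m ≤ t × Full (Gs t))}
  ... | yes found = found
  ... | no none   = ⊥-elim (none (T ⊔ m , m≤n⊔m T m , λ j → vec-ext (λ i →
                       trans (allSet (T ⊔ m) (m≤m⊔n T m) j i) (sym≡ (bit-⊤ i refl)))))
    where
    grows : ∀ j i t → m ≤ t → lookup (Gs (suc t) j) i ≡ lookup (Gs t j) i ∨ hit t j i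
    grows j i t m≤t = accumulate-grows t (Gs t) (full? (Gs t)) (λ full → none (t , m≤t , full)) j i

    settles : ∀ j i → Eventually (λ t → lookup (Gs t j) i ≡ true)
    settles j i with hits j i m
    ... | u , m≤u , hitᵤ = suc u , λ t u<t →
      persists (λ t → lookup (Gs t j) i) (λ t → hit t j i) (grows j i) m≤u hitᵤ (≤⇒≤′ u<t)

    settled : Eventually (λ t → ∀ j i → lookup (Gs t j) i ≡ true)
    settled = eventually-all (λ j t → ∀ i → lookup (Gs t j) i ≡ true)
                             (λ j → eventually-all (λ i t → lookup (Gs t j) i ≡ true) (settles j))

    T : ℕ
    T = proj₁ settled

    allSet : ∀ t → T ≤ t → ∀ j i → lookup (Gs t j) i ≡ true
    allSet = proj₂ settled

resetFlag : ∀ {P : Set} → Dec P → Rst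
resetFlag (yes _) = reset
resetFlag (no _)  = noreset

resetFlag-full : ∀ {P : Set} (d : Dec P) → P → resetFlag d ≡ reset
resetFlag-full (yes _) _ = refl
resetFlag-full (no ¬p) p = ⊥-elim (¬p p)

module Correctness {s k : ℕ} (M : RegSys s) (A A¬ : Fin k → NBA (Fin s))
                   (losp : NFA (Subset k)) where
  open RegSys M
  open Construction M A A¬ losp

  Bookkeeping : Letter → Letter → Set
  Bookkeeping l₁ l₂ =
      (G l₁ ≡ ⊤ × ((G l₂ ≡ ⊥ × ρ l₂ ≡ reset) ⊎ (G l₂ ≡ G l₁ × ρ l₂ ≡ noreset)))
    ⊎ (G l₁ ≢ ⊤ × G l₂ ≡ update l₁ × ρ l₂ ≡ noreset)

  Local : Letter → Letter → Set
  Local l₁ l₂ = (∀ i → NBA.Δ (A i) (ps l₁ i) (sym l₁) (ps l₂ i) ≡ true)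
              × (∀ i → NBA.Δ (A¬ i) (nps l₁ i) (sym l₁) (nps l₂ i) ≡ true)
              × L l₁ ≡ L l₂ × Bookkeeping l₁ l₂

  open LiftedRuns (λ q a q' → DFA.δ T-R q a ≡ just q') (λ q → DFA.acc T-R q ≡ true) sym Local

  monitorOf : Letter → Fin k → Bool
  monitorOf l i = monitor (A i) (A¬ i) (lookup (L l) i) (ps l i) (nps l i)

  -- update only adds elements, so a full accumulator stays full.
  update-full : ∀ l → G l ≡ ⊤ → update l ≡ G l
  update-full l full = vec-ext λ i → trans (lookup∘tabulate _ i)
    (trans (cong (_∨ monitorOf l i) (bit-⊤ i full)) (sym≡ (bit-⊤ i full)))

  lepWord-unique : ∀ {n} {π : ℕ → Vec (Fin s) n} {Ls Ls′} → IsLepWord A π Ls → IsLepWord A π Ls′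
                 → Ls ≡ Ls′
  lepWord-unique lep lep′ = vec-ext λ j → vec-ext λ i → bool-unique (lep j i) (lep′ j i)

  -- Part (a), at a single position: a stream of letters obeying the local
  -- conditions and reset infinitely often fires every monitor infinitely often.
  module ResetStream (l : ℕ → Letter) (steps : ∀ t → Local (l t) (l (suc t)))
                     (resets : InfOften (λ t → ρ (l t) ≡ reset)) where

    L-constant : ∀ t → L (l t) ≡ L (l 0)
    L-constant zero    = refl
    L-constant (suc t) = trans (sym≡ (proj₁ (proj₂ (proj₂ (steps t))))) (L-constant t)

    bookkeeping : ∀ t → Bookkeeping (l t) (l (suc t))
    bookkeeping t = proj₂ (proj₂ (proj₂ (steps t)))

    emptied : ∀ t → ρ (l (suc t)) ≡ reset → G (l t) ≡ ⊤ × G (l (suc t)) ≡ ⊥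
    emptied t r with bookkeeping t
    ... | inj₁ (full , inj₁ (empty , _)) = full , empty
    ... | inj₁ (_ , inj₂ (_ , nr)) with trans (sym≡ r) nr
    ...   | ()
    emptied t r | inj₂ (_ , _ , nr) with trans (sym≡ r) nr
    ...   | ()

    rises-by-monitor : ∀ u i → lookup (G (l u)) i ≡ false → lookup (G (l (suc u))) i ≡ true
                     → monitorOf (l u) i ≡ true
    rises-by-monitor u i off on with bookkeeping u
    ... | inj₁ (full , _) with trans (sym≡ (bit-⊤ i full)) off
    ...   | ()
    rises-by-monitor u i off on | inj₂ (_ , updated , _) =
      subst (λ b → b ∨ monitorOf (l u) i ≡ true) off
        (trans (sym≡ (lookup∘tabulate _ i)) (trans (cong (λ g → lookup g i) (sym≡ updated)) on))

    emptied-after : ∀ m → ∃[ t ] (m ≤ t × G (l t) ≡ ⊤ × G (l (suc t)) ≡ ⊥)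
    emptied-after m with resets (suc m)
    ... | zero  , () , _
    ... | suc t , s≤s m≤t , r = t , m≤t , emptied t r

    -- Between two resets every bit rises from ∅ to LEP, hence the monitor fires.
    monitor-fires : ∀ i → InfOften (λ t → monitorOf (l t) i ≡ true)
    monitor-fires i m with emptied-after m
    ... | t₁ , m≤t₁ , _ , empty with emptied-after (suc t₁)
    ...   | t₂ , t₁<t₂ , full , _ with rise (λ t → lookup (G (l t)) i) (≤⇒≤′ t₁<t₂) (bit-⊥ i empty) (bit-⊤ i full)
    ...     | u , t₁<u , off , on = u , ≤-trans (m≤n⇒m≤1+n m≤t₁) t₁<u , rises-by-monitor u i off on

    monitoredRuns : (∀ i → ps (l 0) i ≡ NBA.q₀ (A i)) → (∀ i → nps (l 0) i ≡ NBA.q₀ (A¬ i))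
                  → ∀ i → MonitoredRuns (A i) (A¬ i) (λ t → sym (l t)) (lookup (L (l 0)) i)
    monitoredRuns starts starts¬ i = record
      { run = λ t → ps (l t) i ; run-start = starts i ; run-step = λ t → proj₁ (steps t) i
      ; run¬ = λ t → nps (l t) i ; run¬-start = starts¬ i ; run¬-step = λ t → proj₁ (proj₂ (steps t)) i
      ; fires = λ m → let u , m≤u , fired = monitor-fires i m in u , m≤u ,
          subst (λ Lᵤ → monitor (A i) (A¬ i) (lookup Lᵤ i) (ps (l u) i) (nps (l u) i) ≡ true)
                (L-constant u) fired }

  -- Part (a): the projection of an accepting execution of M^a is an execution
  -- of M whose lep-word is the guessed word L, which ℓosp rejects.
  soundness : (∀ i (x : ℕ → Fin s) → BAccepts (A¬ i) x → ¬ BAccepts (A i) x)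
            → ∀ (n : ℕ) (πa : ℕ → Vec Letter n) → IsAccExecA πa
            → IsExec M (λ t → map sym (πa t)) × ¬ Satisfies A losp (λ t → map sym (πa t))
  soundness disjoint n πa ((initial , starts , rejected) , trans-a , resets) =
    (initial , λ t → run-forget (πa t) (πa (suc t)) (trans-a t)) , unsatisfied
    where
    π : ℕ → Vec (Fin s) n
    π t = map sym (πa t)

    monitored : ∀ j i → MonitoredRuns (A i) (A¬ i) (Proj π j) (lookup (L (lookup (πa 0) j)) i)
    monitored j i = monitoredRuns-cong (A i) (A¬ i) (λ t → sym≡ (lookup-map j sym (πa t)))
      (ResetStream.monitoredRuns (λ t → lookup (πa t) j)
         (λ t → run-local (πa t) (πa (suc t)) (trans-a t) j)
         (λ m → let t , m≤t , all-reset = resets m in t , m≤t , all-reset j)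
         (proj₁ (starts j)) (proj₁ (proj₂ (starts j))) i)

    guessed : IsLepWord A π (map L (πa 0))
    guessed j i = subst (λ Lⱼ → lookup Lⱼ i ≡ true ⇔ BAccepts (A i) (Proj π j))
      (sym≡ (lookup-map j L (πa 0))) (membership (A i) (A¬ i) (disjoint i (Proj π j)) (monitored j i))

    unsatisfied : ¬ Satisfies A losp π
    unsatisfied (Ls , lep , accepted) =
      rejected (subst (λ V → NFAAccepts losp (toList V)) (lepWord-unique {π = π} lep guessed) accepted)

  -- Part (b): guess L_j by excluded middle, run the monitored automata, and
  -- drive G and ρ by the resetting accumulator.
  module Completeness (em : ExcludedMiddle 0ℓ)
           (complete : ∀ i → Complete (A i)) (complete¬ : ∀ i → Complete (A¬ i))
           (complementary : ∀ i (x : ℕ → Fin s) → BAccepts (A¬ i) x ⇔ (¬ BAccepts (A i) x))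
           {n : ℕ} (π : ℕ → Vec (Fin s) n) (exec : IsExec M π) (unsat : ¬ Satisfies A losp π) where

    guess : ∀ j i → ∃[ b ] MonitoredRuns (A i) (A¬ i) (Proj π j) b
    guess j i = monitoredRuns-exist em (complete i) (complete¬ i) (Proj π j)
                  (Equivalence.from (complementary i (Proj π j)))

    Ls : Fin n → Subset k
    Ls j = tabulate (λ i → proj₁ (guess j i))

    W : ∀ j i → MonitoredRuns (A i) (A¬ i) (Proj π j) (lookup (Ls j) i)
    W j i = subst (MonitoredRuns (A i) (A¬ i) (Proj π j)) (sym≡ (lookup∘tabulate _ i)) (proj₂ (guess j i))

    lepWord : IsLepWord A π (tabulate Ls)
    lepWord j i = subst (λ Lⱼ → lookup Lⱼ i ≡ true ⇔ BAccepts (A i) (Proj π j))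
      (sym≡ (lookup∘tabulate Ls j))
      (membership (A i) (A¬ i) (Equivalence.to (complementary i _)) (W j i))

    open Accumulator (λ t j i → monitor (A i) (A¬ i) (lookup (Ls j) i) (run (W j i) t) (run¬ (W j i) t))

    letter : ℕ → Fin n → Subset k → Rst → Letter
    letter t j g r = mkLetter (lookup (π t) j) (λ i → run (W j i) t) (λ i → run¬ (W j i) t) (Ls j) g r

    ρs : ℕ → Rst
    ρs zero    = noreset
    ρs (suc t) = resetFlag (full? (Gs t))

    πa : ℕ → Vec Letter n
    πa t = tabulate (λ j → letter t j (Gs t j) (ρs t))

    at : ∀ t j → lookup (πa t) j ≡ letter t j (Gs t j) (ρs t)
    at t j = lookup∘tabulate _ j

    projects : ∀ t → map sym (πa t) ≡ π t
    projects t = vec-ext λ j → trans (lookup-map j sym (πa t)) (cong sym (at t j))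

    accumulator-step : ∀ t g (d : Dec (Full g)) j r
                     → Bookkeeping (letter t j (g j) r) (letter (suc t) j (accumulate t g d j) (resetFlag d))
    accumulator-step t g (yes full) j r = inj₁ (full j , inj₁ (refl , refl))
    accumulator-step t g (no _) j r with ≡-dec _≟ᵇ_ (g j) ⊤
    ... | yes fullⱼ = inj₁ (fullⱼ , inj₂ (update-full (letter t j (g j) r) fullⱼ , refl))
    ... | no notFullⱼ = inj₂ (notFullⱼ , refl , refl)

    local : ∀ t j → Local (lookup (πa t) j) (lookup (πa (suc t)) j)
    local t j = subst₂ Local (sym≡ (at t j)) (sym≡ (at (suc t) j))
      ( (λ i → run-step (W j i) t) , (λ i → run¬-step (W j i) t) , refl
      , accumulator-step t (Gs t) (full? (Gs t)) j (ρs t))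

    steps : ∀ t → InRa (πa t) (πa (suc t))
    steps t = run-lift (πa t) (πa (suc t))
      (subst₂ (λ u v → InR M u v) (sym≡ (projects t)) (sym≡ (projects (suc t))) (proj₂ exec t))
      (local t)

    initial : InitA (πa 0)
    initial = subst (λ w → DFAAccepts A-S₀ (toList w)) (sym≡ (projects 0)) (proj₁ exec)
      , (λ j → subst (λ l → (∀ i → ps l i ≡ NBA.q₀ (A i)) × (∀ i → nps l i ≡ NBA.q₀ (A¬ i))
                            × G l ≡ ⊥ × ρ l ≡ noreset) (sym≡ (at 0 j))
                 ((λ i → run-start (W j i)) , (λ i → run¬-start (W j i)) , refl , refl))
      , λ accepted → unsat (tabulate Ls , lepWord ,
          subst (λ V → NFAAccepts losp (toList V)) (vec-ext λ j → trans (lookup-map j L (πa 0))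
                  (trans (cong L (at 0 j)) (sym≡ (lookup∘tabulate Ls j)))) accepted)

    -- Resets occur right after each of the infinitely many full accumulators.
    accepting : InfOften (λ t → InFA (πa t))
    accepting m with full-infinitely-often em (λ j i → fires (W j i)) m
    ... | t , m≤t , full = suc t , m≤n⇒m≤1+n m≤t ,
      λ j → trans (cong ρ (at (suc t) j)) (resetFlag-full (full? (Gs t)) full)

theorem30 : ∀ {s k : ℕ} (M : RegSys s) (A A¬ : Fin k → NBA (Fin s))
    → (∀ i → Complete (A i)) → (∀ i → Complete (A¬ i))
    → (∀ i (x : ℕ → Fin s) → (BAccepts (A¬ i) x ⇔ (¬ BAccepts (A i) x)))
    → (losp : NFA (Subset k))
    → let open Construction M A A¬ losp in
      (∀ (n : ℕ) (πa : ℕ → Vec Letter n) → IsAccExecA πa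
         → IsExec M (λ t → map sym (πa t)) × ¬ Satisfies A losp (λ t → map sym (πa t)))
    × (ExcludedMiddle 0ℓ → ∀ (n : ℕ) (π : ℕ → Vec (Fin s) n) → IsExec M π → ¬ Satisfies A losp π
         → ∃[ πa ] (IsAccExecA {n} πa × (∀ t → map sym (πa t) ≡ π t)))
theorem30 M A A¬ complete complete¬ complementary losp =
    soundness (λ i x → Equivalence.to (complementary i x))
  , λ em n π exec unsat →
      let open Completeness em complete complete¬ complementary π exec unsat in
      πa , (initial , steps , accepting) , projects
  where open Correctness M A A¬ losp
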